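{- Let $G$ be a subgroup of $S_6$ (the Lunn–Senior group of substitution isomerism of an organic compound consisting of a skeleton with six univalent substituents) such that $n_{(5,1);G}=1$ and $n_{(4,2);G}\geq 3$. If $|G|=12$, then $n_{(4,2);G}=3$ (exactly three di-substitution homogeneous derivatives), $n_{(4,1,1);G}\leq 3$ (at most three di-substitution heterogeneous derivatives), and $n_{(3,3);G}\leq 3$ (at most three tri-substitution homogeneous derivatives).
   Context: For a partition $\lambda=(\lambda_1,\dots,\lambda_6)$ of $6$ (with $\lambda_1\geq\cdots\geq\lambda_6\geq 0$, $\sum\lambda_k=6$), a tabloid of shape $\lambda$ is an ordered tuple $(A_1,\dots,A_6)$ of pairwise disjoint subsets of $\{1,\dots,6\}$ with union $\{1,\dots,6\}$ and $|A_k|=\lambda_k$ for all $k$. A subgroup $G\le S_6$ acts on tabloids of shape $\lambda$ by $\sigma(A_1,\dots,A_6)=(\sigma(A_1),\dots,\sigma(A_6))$, and $n_{\lambda;G}$ denotes the number of $G$-orbits on the set of tabloids of shape $\lambda$. Partitions are written omitting zero parts. In the chemical interpretation, orbits of shape $(5,1)$ are mono-substitution derivatives, $(4,2)$ di-substitution homogeneous, $(4,1,1)$ di-substitution heterogeneous, and $(3,3)$ tri-substitution homogeneous derivatives. -}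

module Defs where

open import Data.Nat using (ℕ)
open import Data.Bool using (Bool; true; false; _∧_; _∨_; if_then_else_)
open import Data.Fin using (Fin; _≟_)
open import Data.Vec using (Vec; _∷_; []; lookup; tabulate; allFin; foldr; map)
open import Data.Fin.Subset using (Subset; ∣_∣; ⊤; _∪_) renaming (Empty to EmptySubset)
open import Data.List using (List; length)
open import Data.List.Membership.Propositional using (_∈_)
open import Data.List.Relation.Unary.All using (All)
open import Data.List.Relation.Unary.Any using (Any)
open import Data.List.Relation.Unary.Unique.Propositional using (Unique)
open import Data.List.Relation.Unary.AllPairs using (AllPairs)
open import Data.Product using (Σ; _×_; ∃-syntax)
open import Relation.Binary.PropositionalEquality using (_≡_; _≢_)
open import Relation.Nullary using (¬_)
open import Relation.Nullary.Decidable using (⌊_⌋)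
import Data.Fin.Subset as S

-- Points {1,…,6} are represented by Fin 6.
-- A permutation of {1,…,6} is represented by its table σ = (σ(0),…,σ(5)),
-- required to be injective (hence bijective).
Perm : Set
Perm = Vec (Fin 6) 6

IsPerm : Perm → Set
IsPerm σ = ∀ i j → lookup σ i ≡ lookup σ j → i ≡ j

idP : Perm
idP = allFin 6

_∘P_ : Perm → Perm → Perm
σ ∘P τ = tabulate (λ i → lookup σ (lookup τ i))

-- A subgroup G ≤ S₆, given as a duplicate-free list of its elements
-- (so |G| = length G).
record IsSubgroup (G : List Perm) : Set where
  field
    perms   : All IsPerm G
    nodup   : Unique G
    hasId   : idP ∈ G
    closed  : ∀ {σ τ} → σ ∈ G → τ ∈ G → (σ ∘P τ) ∈ G
    inverse : ∀ {σ} → σ ∈ G → ∃[ τ ] (τ ∈ G × (τ ∘P σ ≡ idP) × (σ ∘P τ ≡ idP))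

image : Perm → Subset 6 → Subset 6
image σ A = tabulate (λ y → foldr (λ _ → Bool) _∨_ false
                               (map (λ x → lookup A x ∧ ⌊ lookup σ x ≟ y ⌋) (allFin 6)))

-- A candidate tabloid: an ordered 6-tuple (A₁,…,A₆) of subsets of {1,…,6}.
Tuple : Set
Tuple = Vec (Subset 6) 6

-- Shapes: λ = (λ₁,…,λ₆) with zero parts written explicitly.
Shape : Set
Shape = Vec ℕ 6

record IsTabloid (lam : Shape) (T : Tuple) : Set where
  field
    disjoint : ∀ k l → k ≢ l → EmptySubset (lookup T k S.∩ lookup T l)
    cover    : foldr (λ _ → Subset 6) _∪_ S.⊥ T ≡ ⊤
    sizes    : ∀ k → ∣ lookup T k ∣ ≡ lookup lam k

act : Perm → Tuple → Tuple
act σ T = map (image σ) T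

SameOrbit : List Perm → Tuple → Tuple → Set
SameOrbit G T T' = ∃[ σ ] (σ ∈ G × act σ T ≡ T')

-- n_{λ;G} = n: there is a list of n tabloids of shape λ, pairwise in
-- different G-orbits, such that every tabloid of shape λ is in the orbit
-- of one of them (a complete set of orbit representatives).
OrbitCount : List Perm → Shape → ℕ → Set
OrbitCount G lam n =
  ∃[ reps ] ( length reps ≡ n
            × All (IsTabloid lam) reps
            × AllPairs (λ T T' → ¬ SameOrbit G T T') reps
            × (∀ T → IsTabloid lam T → Any (λ R → SameOrbit G R T) reps))

λ51 λ42 λ411 λ33 : Shape
λ51  = 5 ∷ 1 ∷ 0 ∷ 0 ∷ 0 ∷ 0 ∷ []
λ42  = 4 ∷ 2 ∷ 0 ∷ 0 ∷ 0 ∷ 0 ∷ []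
λ411 = 4 ∷ 1 ∷ 1 ∷ 0 ∷ 0 ∷ 0 ∷ []
λ33  = 3 ∷ 3 ∷ 0 ∷ 0 ∷ 0 ∷ 0 ∷ []

-- Since n_(5,1) = 1, G is transitive on the six points, so by orbit–stabilizer every point
-- stabilizer has 12 / 6 = 2 elements; in particular G contains some t ≠ id fixing 0, every
-- duplicate-free K ⊆ G has at most 12 elements, and at most 2 of them fix any given point.
-- G is then reached by a finite search: starting from {t}, repeatedly adjoin an element of G
-- sending 0 to a point not yet reached from 0 (trying all 120 candidates), and discard every
-- closure violating the two bounds.  Each transitive K found carries a list of at most three
-- tabloids of shape (4,2), (4,1,1) and (3,3) meeting every K-orbit, hence every G-orbit; for
-- the remaining K such a list shows n_(4,2) ≤ 2, which the hypothesis n_(4,2) ≥ 3 excludes.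
module Submission where

open import Defs
open import Data.Bool using (Bool; true; false; _∧_; _∨_; T; if_then_else_)
open import Data.Bool.ListAction using (all)
open import Data.Bool.Properties using (⇔→≡; ∨-zeroʳ; ∧-conicalˡ; ∧-conicalʳ; T-∨; T-≡)
import Data.Bool.Properties as Bool
open import Data.Fin using (Fin; zero; suc; #_)
open import Data.Fin.Properties using (_≟_; suc-injective)
import Data.Fin.Properties as Fin
open import Data.Fin.Subset using (Subset; ⊤; ∣_∣; _∩_; _∪_; ⁅_⁆; ∁)
import Data.Fin.Subset as Subset
open import Data.Fin.Subset.Properties using (nonempty?; x∈⁅x⁆; x∈⁅y⁆⇒x≡y)
open import Data.List as List using (List; []; _∷_; length; cartesianProductWith)
open import Data.List.Properties using (length-++; length-map; length-removeAt′)
open import Data.List.Membership.Propositional using (_∈_; _∉_; find; lose)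
open import Data.List.Membership.Propositional.Properties
  using (∈-map⁺; ∈-map⁻; ∈-allFin; ∈-filter⁺; ∈-concat⁺′; ∈-cartesianProductWith⁺; ∈-cartesianProductWith⁻)
open import Data.List.Relation.Unary.All as All using (All; []; _∷_)
import Data.List.Relation.Unary.All.Properties as All
open import Data.List.Relation.Unary.Any as Any using (Any; here; there)
open import Data.List.Relation.Unary.AllPairs using (AllPairs; []; _∷_)
open import Data.List.Relation.Unary.Unique.Propositional using (Unique)
import Data.List.Relation.Unary.Unique.Propositional.Properties as Unique
open import Data.List.Relation.Binary.Pointwise using (Pointwise; []; _∷_; Pointwise-length)
open import Data.Maybe using (Maybe; just; nothing)
open import Data.Nat using (ℕ; _+_; _*_; _≤_; _<_; _≥_; _<ᵇ_; _≤ᵇ_; s≤s; z≤n)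
import Data.Nat.Properties as ℕ
open import Data.Product using (_×_; _,_; ∃-syntax; proj₁; proj₂)
open import Data.Sum using (_⊎_; inj₁; inj₂)
open import Data.Vec as Vec using (Vec; []; _∷_; lookup; tabulate; allFin; foldr)
open import Data.Vec.Properties using (lookup∘tabulate; tabulate∘lookup; tabulate-cong; lookup-allFin;
  tabulate-allFin; map-cong; map-∘; map-id; []=⇒lookup; lookup⇒[]=; ∷-injective)
open import Function using (_∘_; _⇔_; mk⇔; Equivalence)
open import Relation.Binary.Definitions using (DecidableEquality)
open import Relation.Binary.PropositionalEquality
open import Relation.Nullary using (¬_; Dec; yes; no; does; _because_; Reflects; ofʸ; ofⁿ; ¬?; T?;
  _×-dec_; _⊎-dec_; _→-dec_; contradiction)
open import Relation.Nullary.Decidable using (⌊_⌋; toWitness; map′; dec-true; isYes≗does)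
open import Relation.Unary using (Decidable)

open ≡-Reasoning

-- Leaner than Data.Fin.Properties._≟_ and Data.Vec.Properties.≡-dec: here `does` is a bare
-- Boolean recursion, which is what the type checker evaluates when it runs the search below.
_==_ : ∀ {n} → Fin n → Fin n → Bool
zero  == zero  = true
suc i == suc j = i == j
_     == _     = false

==-reflects : ∀ {n} (i j : Fin n) → Reflects (i ≡ j) (i == j)
==-reflects zero    zero    = ofʸ refl
==-reflects zero    (suc j) = ofⁿ λ ()
==-reflects (suc i) zero    = ofⁿ λ ()
==-reflects (suc i) (suc j) with i == j | ==-reflects i j
... | true  | ofʸ refl = ofʸ refl
... | false | ofⁿ i≢j  = ofⁿ (i≢j ∘ suc-injective)

_≟ᶠ_ : ∀ {n} → DecidableEquality (Fin n)
i ≟ᶠ j = (i == j) because ==-reflects i j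

module Decide {A : Set} (_≟ᵃ_ : DecidableEquality A) where

  _==ᵥ_ : ∀ {n} → Vec A n → Vec A n → Bool
  []       ==ᵥ []       = true
  (x ∷ xs) ==ᵥ (y ∷ ys) = does (x ≟ᵃ y) ∧ (xs ==ᵥ ys)

  ==ᵥ-reflects : ∀ {n} (u v : Vec A n) → Reflects (u ≡ v) (u ==ᵥ v)
  ==ᵥ-reflects []       []       = ofʸ refl
  ==ᵥ-reflects (x ∷ xs) (y ∷ ys) with x ≟ᵃ y
  ... | no x≢y   = ofⁿ (x≢y ∘ proj₁ ∘ ∷-injective)
  ... | yes refl with xs ==ᵥ ys | ==ᵥ-reflects xs ys
  ...   | true  | ofʸ refl  = ofʸ refl
  ...   | false | ofⁿ xs≢ys = ofⁿ (xs≢ys ∘ proj₂ ∘ ∷-injective)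

  ≟-Vec : ∀ {n} → DecidableEquality (Vec A n)
  ≟-Vec u v = (u ==ᵥ v) because ==ᵥ-reflects u v

  _∈ᵇ_ : A → List A → Bool
  x ∈ᵇ []       = false
  x ∈ᵇ (y ∷ ys) = does (x ≟ᵃ y) ∨ (x ∈ᵇ ys)

  ∈ᵇ-reflects : ∀ x ys → Reflects (x ∈ ys) (x ∈ᵇ ys)
  ∈ᵇ-reflects x []       = ofⁿ λ ()
  ∈ᵇ-reflects x (y ∷ ys) with x ≟ᵃ y
  ... | yes x≡y = ofʸ (here x≡y)
  ... | no  x≢y with x ∈ᵇ ys | ∈ᵇ-reflects x ys
  ...   | true  | ofʸ x∈ys = ofʸ (there x∈ys)
  ...   | false | ofⁿ x∉ys = ofⁿ λ { (here x≡y) → x≢y x≡y ; (there x∈ys) → x∉ys x∈ys }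

  _∈?_ : ∀ x ys → Dec (x ∈ ys)
  x ∈? ys = (x ∈ᵇ ys) because ∈ᵇ-reflects x ys

open Decide using (≟-Vec)

_≟ₚ_ : DecidableEquality Perm
_≟ₚ_ = ≟-Vec _≟ᶠ_

_≟ₛ_ : DecidableEquality (Subset 6)
_≟ₛ_ = ≟-Vec Bool._≟_

_≟ₜ_ : DecidableEquality Tuple
_≟ₜ_ = ≟-Vec _≟ₛ_

all-true⇒ : ∀ {A : Set} (p : A → Bool) xs → all p xs ≡ true → ∀ {x} → x ∈ xs → p x ≡ true
all-true⇒ p (y ∷ ys) all-p (here refl)  = ∧-conicalˡ (p y) _ all-p
all-true⇒ p (y ∷ ys) all-p (there x∈ys) = all-true⇒ p ys (∧-conicalʳ (p y) _ all-p) x∈ys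

-- Permutations and their action on tabloids

Vec-ext : ∀ {A : Set} {n} {u v : Vec A n} → (∀ i → lookup u i ≡ lookup v i) → u ≡ v
Vec-ext {u = u} {v} eq = trans (sym (tabulate∘lookup u)) (trans (tabulate-cong eq) (tabulate∘lookup v))

lookup-∘P : ∀ σ τ i → lookup (σ ∘P τ) i ≡ lookup σ (lookup τ i)
lookup-∘P σ τ = lookup∘tabulate (λ j → lookup σ (lookup τ j))

lookup-idP : ∀ i → lookup idP i ≡ i
lookup-idP = lookup-allFin

∘P-assoc : ∀ σ τ ρ → (σ ∘P τ) ∘P ρ ≡ σ ∘P (τ ∘P ρ)
∘P-assoc σ τ ρ = Vec-ext λ i → begin
  lookup ((σ ∘P τ) ∘P ρ) i          ≡⟨ lookup-∘P (σ ∘P τ) ρ i ⟩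
  lookup (σ ∘P τ) (lookup ρ i)      ≡⟨ lookup-∘P σ τ (lookup ρ i) ⟩
  lookup σ (lookup τ (lookup ρ i))  ≡⟨ cong (lookup σ) (lookup-∘P τ ρ i) ⟨
  lookup σ (lookup (τ ∘P ρ) i)      ≡⟨ lookup-∘P σ (τ ∘P ρ) i ⟨
  lookup (σ ∘P (τ ∘P ρ)) i          ∎

∘P-identityˡ : ∀ σ → idP ∘P σ ≡ σ
∘P-identityˡ σ = Vec-ext λ i → trans (lookup-∘P idP σ i) (lookup-idP (lookup σ i))

∘P-identityʳ : ∀ σ → σ ∘P idP ≡ σ
∘P-identityʳ σ = Vec-ext λ i → trans (lookup-∘P σ idP i) (cong (lookup σ) (lookup-idP i))

∘P-cancelˡ : ∀ {σ τ ρ} → IsPerm σ → σ ∘P τ ≡ σ ∘P ρ → τ ≡ ρ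
∘P-cancelˡ {σ} {τ} {ρ} σ-injective στ≡σρ = Vec-ext λ i → σ-injective _ _ (begin
  lookup σ (lookup τ i)  ≡⟨ lookup-∘P σ τ i ⟨
  lookup (σ ∘P τ) i      ≡⟨ cong (λ π → lookup π i) στ≡σρ ⟩
  lookup (σ ∘P ρ) i      ≡⟨ lookup-∘P σ ρ i ⟩
  lookup σ (lookup ρ i)  ∎)

lookup-inverse : ∀ {σ τ} → τ ∘P σ ≡ idP → ∀ i → lookup τ (lookup σ i) ≡ i
lookup-inverse {σ} {τ} τσ≡id i = begin
  lookup τ (lookup σ i)  ≡⟨ lookup-∘P τ σ i ⟨
  lookup (τ ∘P σ) i      ≡⟨ cong (λ π → lookup π i) τσ≡id ⟩
  lookup idP i           ≡⟨ lookup-idP i ⟩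
  i                      ∎

∨-tabulate⁻ : ∀ {n} (f : Fin n → Bool) → foldr (λ _ → Bool) _∨_ false (tabulate f) ≡ true → ∃[ x ] f x ≡ true
∨-tabulate⁻ {ℕ.suc n} f any-f with f zero in f0
... | true  = zero , f0
... | false = let x , fx = ∨-tabulate⁻ (f ∘ suc) any-f in suc x , fx

∨-tabulate⁺ : ∀ {n} (f : Fin n → Bool) x → f x ≡ true → foldr (λ _ → Bool) _∨_ false (tabulate f) ≡ true
∨-tabulate⁺ f zero    fx rewrite fx = refl
∨-tabulate⁺ f (suc x) fx = trans (cong (f zero ∨_) (∨-tabulate⁺ (f ∘ suc) x fx)) (∨-zeroʳ (f zero))

∈-image : ∀ σ A y → lookup (image σ A) y ≡ true ⇔ (∃[ x ] (lookup A x ≡ true × lookup σ x ≡ y))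
∈-image σ A y = mk⇔ to from
  where
  f : Fin 6 → Bool
  f x = lookup A x ∧ ⌊ lookup σ x ≟ y ⌋

  unfold : lookup (image σ A) y ≡ foldr (λ _ → Bool) _∨_ false (tabulate f)
  unfold = trans (lookup∘tabulate (λ y → foldr (λ _ → Bool) _∨_ false (Vec.map (λ x → lookup A x ∧ ⌊ lookup σ x ≟ y ⌋) (allFin 6))) y)
                 (cong (foldr (λ _ → Bool) _∨_ false) (sym (tabulate-allFin f)))

  to : lookup (image σ A) y ≡ true → ∃[ x ] (lookup A x ≡ true × lookup σ x ≡ y)
  to y∈ = let x , fx = ∨-tabulate⁻ f (trans (sym unfold) y∈) in
    x , ∧-conicalˡ (lookup A x) _ fx , toWitness {a? = lookup σ x ≟ y} (Equivalence.from T-≡ (∧-conicalʳ (lookup A x) _ fx))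

  from : ∃[ x ] (lookup A x ≡ true × lookup σ x ≡ y) → lookup (image σ A) y ≡ true
  from (x , x∈A , σx≡y) =
    trans unfold (∨-tabulate⁺ f x (cong₂ _∧_ x∈A (trans (isYes≗does (lookup σ x ≟ y)) (dec-true (lookup σ x ≟ y) σx≡y))))

image-∘P : ∀ σ τ A → image (σ ∘P τ) A ≡ image σ (image τ A)
image-∘P σ τ A = Vec-ext λ y → ⇔→≡ (mk⇔ (to y) (from y))
  where
  to : ∀ y → lookup (image (σ ∘P τ) A) y ≡ true → lookup (image σ (image τ A)) y ≡ true
  to y y∈ = let x , x∈A , στx≡y = Equivalence.to (∈-image (σ ∘P τ) A y) y∈ in
    Equivalence.from (∈-image σ (image τ A) y)
      (lookup τ x , Equivalence.from (∈-image τ A _) (x , x∈A , refl) , trans (sym (lookup-∘P σ τ x)) στx≡y)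

  from : ∀ y → lookup (image σ (image τ A)) y ≡ true → lookup (image (σ ∘P τ) A) y ≡ true
  from y y∈ = let z , z∈τA , σz≡y = Equivalence.to (∈-image σ (image τ A) y) y∈
                  x , x∈A , τx≡z  = Equivalence.to (∈-image τ A z) z∈τA in
    Equivalence.from (∈-image (σ ∘P τ) A y) (x , x∈A , trans (lookup-∘P σ τ x) (trans (cong (lookup σ) τx≡z) σz≡y))

image-idP : ∀ A → image idP A ≡ A
image-idP A = Vec-ext λ y → ⇔→≡ (mk⇔ (to y) (from y))
  where
  to : ∀ y → lookup (image idP A) y ≡ true → lookup A y ≡ true
  to y y∈ = let x , x∈A , x≡y = Equivalence.to (∈-image idP A y) y∈ in
    subst (λ z → lookup A z ≡ true) (trans (sym (lookup-idP x)) x≡y) x∈A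

  from : ∀ y → lookup A y ≡ true → lookup (image idP A) y ≡ true
  from y y∈A = Equivalence.from (∈-image idP A y) (y , y∈A , lookup-idP y)

act-∘P : ∀ σ τ T → act (σ ∘P τ) T ≡ act σ (act τ T)
act-∘P σ τ T = trans (map-cong (image-∘P σ τ) T) (map-∘ (image σ) (image τ) T)

act-idP : ∀ T → act idP T ≡ T
act-idP T = trans (map-cong image-idP T) (map-id T)

-- The preimage ρ⁻¹(A); unlike `image` it is computed without searching for preimages.
pullback : Perm → Subset 6 → Subset 6
pullback ρ A = tabulate (λ y → lookup A (lookup ρ y))

image-inverse : ∀ {ρ τ} → τ ∘P ρ ≡ idP → ρ ∘P τ ≡ idP → ∀ A → image τ A ≡ pullback ρ A
image-inverse {ρ} {τ} τρ≡id ρτ≡id A = Vec-ext λ y → ⇔→≡ (mk⇔ (to y) (from y))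
  where
  to : ∀ y → lookup (image τ A) y ≡ true → lookup (pullback ρ A) y ≡ true
  to y y∈ = let x , x∈A , τx≡y = Equivalence.to (∈-image τ A y) y∈ in
    trans (lookup∘tabulate (λ y → lookup A (lookup ρ y)) y)
          (subst (λ z → lookup A z ≡ true) (sym (trans (cong (lookup ρ) (sym τx≡y)) (lookup-inverse {τ} {ρ} ρτ≡id x))) x∈A)

  from : ∀ y → lookup (pullback ρ A) y ≡ true → lookup (image τ A) y ≡ true
  from y y∈ = Equivalence.from (∈-image τ A y)
    (lookup ρ y , trans (sym (lookup∘tabulate (λ y → lookup A (lookup ρ y)) y)) y∈ , lookup-inverse {ρ} {τ} τρ≡id y)

pullback-idP : ∀ (T : Tuple) → Vec.map (pullback idP) T ≡ T
pullback-idP T = trans (map-cong (λ A → Vec-ext λ y → trans (lookup∘tabulate (λ y → lookup A (lookup idP y)) y)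
                                                            (cong (lookup A) (lookup-idP y))) T)
                       (map-id T)

isTabloid? : ∀ lam → Decidable (IsTabloid lam)
isTabloid? lam T = map′
  (λ (d , c , s) → record { disjoint = d ; cover = c ; sizes = s })
  (λ t → IsTabloid.disjoint t , IsTabloid.cover t , IsTabloid.sizes t)
  (Fin.all? (λ k → Fin.all? (λ l → ¬? (k ≟ l) →-dec ¬? (nonempty? (lookup T k ∩ lookup T l))))
   ×-dec foldr (λ _ → Subset 6) _∪_ Subset.⊥ T ≟ₛ ⊤
   ×-dec Fin.all? (λ k → ∣ lookup T k ∣ ℕ.≟ lookup lam k))

tabloid51 : Fin 6 → Tuple
tabloid51 j = ∁ ⁅ j ⁆ ∷ ⁅ j ⁆ ∷ Subset.⊥ ∷ Subset.⊥ ∷ Subset.⊥ ∷ Subset.⊥ ∷ []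

tabloid51-isTabloid : ∀ j → IsTabloid λ51 (tabloid51 j)
tabloid51-isTabloid = toWitness {a? = Fin.all? (λ j → isTabloid? λ51 (tabloid51 j))} _

act-tabloid51 : ∀ g {i j} → act g (tabloid51 i) ≡ tabloid51 j → lookup g i ≡ j
act-tabloid51 g {i} {j} gi≡j = x∈⁅y⁆⇒x≡y j (lookup⇒[]= _ ⁅ j ⁆ (subst (λ A → lookup A (lookup g i) ≡ true)
  (cong (λ T → lookup T (# 1)) gi≡j)
  (Equivalence.from (∈-image g ⁅ i ⁆ _) (i , []=⇒lookup (x∈⁅x⁆ i) , refl))))

allVecs : ∀ {A : Set} → List A → ∀ n → List (Vec A n)
allVecs xs ℕ.zero    = [] ∷ []
allVecs xs (ℕ.suc n) = cartesianProductWith _∷_ xs (allVecs xs n)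

∈-allVecs : ∀ {A : Set} {xs : List A} → (∀ x → x ∈ xs) → ∀ {n} (v : Vec A n) → v ∈ allVecs xs n
∈-allVecs every []      = here refl
∈-allVecs every (x ∷ v) = ∈-cartesianProductWith⁺ _∷_ (every x) (∈-allVecs every v)

subsetsOfSize : ℕ → List (Subset 6)
subsetsOfSize k = List.filter (λ A → ∣ A ∣ ℕ.≟ k) (allVecs (true ∷ false ∷ []) 6)

tuplesOfSizes : ∀ {n} → Vec ℕ n → List (Vec (Subset 6) n)
tuplesOfSizes []       = [] ∷ []
tuplesOfSizes (k ∷ ks) = cartesianProductWith _∷_ (subsetsOfSize k) (tuplesOfSizes ks)

∈-tuplesOfSizes : ∀ {n} {ks : Vec ℕ n} T → (∀ k → ∣ lookup T k ∣ ≡ lookup ks k) → T ∈ tuplesOfSizes ks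
∈-tuplesOfSizes {ks = []}     []      _     = here refl
∈-tuplesOfSizes {ks = _ ∷ ks} (A ∷ T) sizes = ∈-cartesianProductWith⁺ _∷_
  (∈-filter⁺ (λ A → ∣ A ∣ ℕ.≟ _) (∈-allVecs every-bool A) (sizes zero))
  (∈-tuplesOfSizes {ks = ks} T (sizes ∘ suc))
  where
  every-bool : ∀ b → b ∈ true ∷ false ∷ []
  every-bool true  = here refl
  every-bool false = there (here refl)

tabloids : Shape → List Tuple
tabloids lam = List.filter (λ T → foldr (λ _ → Subset 6) _∪_ Subset.⊥ T ≟ₛ ⊤) (tuplesOfSizes lam)

∈-tabloids : ∀ {lam T} → IsTabloid lam T → T ∈ tabloids lam
∈-tabloids {lam} {T} t = ∈-filter⁺ (λ T → foldr (λ _ → Subset 6) _∪_ Subset.⊥ T ≟ₛ ⊤)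
  (∈-tuplesOfSizes {ks = lam} T (IsTabloid.sizes t)) (IsTabloid.cover t)

-- Counting orbits

module _ {A : Set} where

  ∈-─⁺ : ∀ {x y : A} {ys} (x∈ys : x ∈ ys) → y ∈ ys → x ≢ y → y ∈ (ys Any.─ x∈ys)
  ∈-─⁺ (here refl)  (here refl)  x≢y = contradiction refl x≢y
  ∈-─⁺ (here refl)  (there y∈ys) x≢y = y∈ys
  ∈-─⁺ (there x∈ys) (here refl)  x≢y = here refl
  ∈-─⁺ (there x∈ys) (there y∈ys) x≢y = there (∈-─⁺ x∈ys y∈ys x≢y)

  Unique-⊆⇒length≤ : ∀ {xs ys : List A} → Unique xs → All (_∈ ys) xs → length xs ≤ length ys
  Unique-⊆⇒length≤ [] [] = z≤n
  Unique-⊆⇒length≤ {ys = ys} (x≢xs ∷ xs!) (x∈ys ∷ xs⊆ys) =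
    subst (_ ≤_) (sym (length-removeAt′ ys (Any.index x∈ys)))
      (s≤s (Unique-⊆⇒length≤ xs! (All.zipWith (λ (x≢y , y∈ys) → ∈-─⁺ x∈ys y∈ys x≢y) (x≢xs , xs⊆ys))))

CoveredBy : List Perm → List Tuple → Tuple → Set
CoveredBy H C T = Any (λ c → Any (λ ρ → Vec.map (pullback ρ) c ≡ T) H) C

coveredBy? : ∀ H C → Decidable (CoveredBy H C)
coveredBy? H C T = Any.any? (λ c → Any.any? (λ ρ → Vec.map (pullback ρ) c ≟ₜ T) H) C

module Orbits {G : List Perm} (G-subgroup : IsSubgroup G) where
  open IsSubgroup G-subgroup

  SameOrbit-sym : ∀ {T T′} → SameOrbit G T T′ → SameOrbit G T′ T
  SameOrbit-sym {T} {T′} (σ , σ∈G , σT≡T′) =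
    let τ , τ∈G , τσ≡id , _ = inverse σ∈G in τ , τ∈G , (begin
      act τ T′         ≡⟨ cong (act τ) σT≡T′ ⟨
      act τ (act σ T)  ≡⟨ act-∘P τ σ T ⟨
      act (τ ∘P σ) T   ≡⟨ cong (λ π → act π T) τσ≡id ⟩
      act idP T        ≡⟨ act-idP T ⟩
      T                ∎)

  SameOrbit-trans : ∀ {T T′ T″} → SameOrbit G T T′ → SameOrbit G T′ T″ → SameOrbit G T T″
  SameOrbit-trans {T} (σ , σ∈G , refl) (τ , τ∈G , refl) = τ ∘P σ , closed τ∈G σ∈G , act-∘P τ σ T

  CoveredBy⇒SameOrbit : ∀ {H C T} → All (_∈ G) H → CoveredBy H C T → Any (λ c → SameOrbit G c T) C
  CoveredBy⇒SameOrbit H⊆G = Any.map λ ρ-any →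
    let ρ , ρ∈H , ρ*c≡T = find ρ-any ; τ , τ∈G , τρ≡id , ρτ≡id = inverse (All.lookup H⊆G ρ∈H) in
    τ , τ∈G , trans (map-cong (image-inverse {ρ} {τ} τρ≡id ρτ≡id) _) ρ*c≡T

  -- Sending each representative to an element of C in its orbit is injective.
  orbitCount≤ : ∀ {lam n} C → (∀ T → IsTabloid lam T → Any (λ c → SameOrbit G c T) C) →
                OrbitCount G lam n → n ≤ length C
  orbitCount≤ {lam} C covers (reps , refl , reps-tabloids , reps-apart , _) =
    let cs , cs⊆C , cs~reps = choose reps-tabloids in
    subst (_≤ length C) (Pointwise-length cs~reps) (Unique-⊆⇒length≤ (apart⇒unique cs~reps reps-apart) cs⊆C)
    where
    choose : ∀ {rs} → All (IsTabloid lam) rs → ∃[ cs ] (All (_∈ C) cs × Pointwise (SameOrbit G) cs rs)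
    choose [] = [] , [] , []
    choose {r ∷ _} (r-tabloid ∷ rs-tabloids) =
      let c , c∈C , c~r = find (covers r r-tabloid) ; cs , cs⊆C , cs~rs = choose rs-tabloids in
      c ∷ cs , c∈C ∷ cs⊆C , c~r ∷ cs~rs

    apart⇒unique : ∀ {cs rs} → Pointwise (SameOrbit G) cs rs → AllPairs (λ T T′ → ¬ SameOrbit G T T′) rs → Unique cs
    apart⇒unique [] [] = []
    apart⇒unique (c~r ∷ cs~rs) (r≁rs ∷ rs-apart) = distinct c~r cs~rs r≁rs ∷ apart⇒unique cs~rs rs-apart
      where
      distinct : ∀ {c r cs rs} → SameOrbit G c r → Pointwise (SameOrbit G) cs rs →
                 All (λ r′ → ¬ SameOrbit G r r′) rs → All (c ≢_) cs
      distinct c~r [] [] = []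
      distinct c~r (c′~r′ ∷ cs~rs) (r≁r′ ∷ r≁rs) =
        (λ { refl → r≁r′ (SameOrbit-trans (SameOrbit-sym c~r) c′~r′) }) ∷ distinct c~r cs~rs r≁rs

  transitive : OrbitCount G λ51 1 → ∀ i j → ∃[ g ] (g ∈ G × lookup g i ≡ j)
  transitive (R ∷ [] , _ , _ , _ , covers) i j =
    reach (covers (tabloid51 i) (tabloid51-isTabloid i)) (covers (tabloid51 j) (tabloid51-isTabloid j))
    where
    reach : Any (λ R′ → SameOrbit G R′ (tabloid51 i)) (R ∷ []) → Any (λ R′ → SameOrbit G R′ (tabloid51 j)) (R ∷ []) →
            ∃[ g ] (g ∈ G × lookup g i ≡ j)
    reach (here R~i) (here R~j) =
      let g , g∈G , gi≡j = SameOrbit-trans {tabloid51 i} (SameOrbit-sym {R} R~i) R~j in g , g∈G , act-tabloid51 g gi≡j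

greedyCover : List Perm → List Tuple → List Tuple → List Tuple
greedyCover H C []       = C
greedyCover H C (T ∷ Ts) = if ⌊ coveredBy? H C T ⌋ then greedyCover H C Ts else greedyCover H (T ∷ C) Ts

greedyCover-⊇ : ∀ H C Ts {c} → c ∈ C → c ∈ greedyCover H C Ts
greedyCover-⊇ H C []       c∈C = c∈C
greedyCover-⊇ H C (T ∷ Ts) c∈C with coveredBy? H C T
... | yes _ = greedyCover-⊇ H C Ts c∈C
... | no  _ = greedyCover-⊇ H (T ∷ C) Ts (there c∈C)

CoveredBy-mono : ∀ {H C D T} → (∀ {c} → c ∈ C → c ∈ D) → CoveredBy H C T → CoveredBy H D T
CoveredBy-mono C⊆D covered = let c , c∈C , ρ-any = find covered in lose (C⊆D c∈C) ρ-any

greedyCover-covers : ∀ {H} → idP ∈ H → ∀ C Ts → All (CoveredBy H (greedyCover H C Ts)) Ts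
greedyCover-covers id∈H C []       = []
greedyCover-covers {H} id∈H C (T ∷ Ts) with coveredBy? H C T
... | yes covered = CoveredBy-mono (greedyCover-⊇ H C Ts) covered ∷ greedyCover-covers id∈H C Ts
... | no  _       = CoveredBy-mono (greedyCover-⊇ H (T ∷ C) Ts) (here (Any.map (λ { refl → pullback-idP T }) id∈H))
                    ∷ greedyCover-covers id∈H (T ∷ C) Ts

orbitBoundᵇ : List Perm → Shape → ℕ → Bool
orbitBoundᵇ H lam n = length (greedyCover (idP ∷ H) [] (tabloids lam)) ≤ᵇ n

module _ {G : List Perm} (G-subgroup : IsSubgroup G) where
  open Orbits G-subgroup
  open IsSubgroup G-subgroup using (hasId)

  orbitBoundᵇ-sound : ∀ H lam n {m} → All (_∈ G) H → T (orbitBoundᵇ H lam n) → OrbitCount G lam m → m ≤ n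
  orbitBoundᵇ-sound H lam n H⊆G small count =
    ℕ.≤-trans (orbitCount≤ C (λ T t → CoveredBy⇒SameOrbit (hasId ∷ H⊆G)
                                         (All.lookup (greedyCover-covers (here refl) [] (tabloids lam)) (∈-tabloids t)))
                            count)
              (ℕ.≤ᵇ⇒≤ (length C) n small)
    where
    C = greedyCover (idP ∷ H) [] (tabloids lam)

-- Transitive groups

module Transitive {G : List Perm} (G-subgroup : IsSubgroup G) (reach : ∀ i j → ∃[ g ] (g ∈ G × lookup g i ≡ j)) where
  open IsSubgroup G-subgroup

  module _ (i : Fin 6) where

    private
      h : Fin 6 → Perm
      h j = proj₁ (reach i j)

      h∈G : ∀ j → h j ∈ G
      h∈G j = proj₁ (proj₂ (reach i j))

    -- The cosets h j ∘ S, one for each point j, are disjoint since they send i to j.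
    orbit-stabilizer : ∀ {S} → Unique S → All (_∈ G) S → All (λ σ → lookup σ i ≡ i) S → 6 * length S ≤ length G
    orbit-stabilizer {S} S! S⊆G S-fixes =
      subst (_≤ length G) (cosets-length (List.allFin 6)) (Unique-⊆⇒length≤ (cosets-unique (Unique.allFin⁺ 6)) cosets⊆G)
      where
      cosets : List (Fin 6) → List Perm
      cosets js = cartesianProductWith (λ j σ → h j ∘P σ) js S

      coset-sends : ∀ j σ → σ ∈ S → lookup (h j ∘P σ) i ≡ j
      coset-sends j σ σ∈S =
        trans (lookup-∘P (h j) σ i) (trans (cong (lookup (h j)) (All.lookup S-fixes σ∈S)) (proj₂ (proj₂ (reach i j))))

      cosets-send : ∀ js {v} → v ∈ cosets js → lookup v i ∈ js
      cosets-send js v∈ with ∈-cartesianProductWith⁻ (λ j σ → h j ∘P σ) js S v∈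
      ... | j , σ , j∈js , σ∈S , refl = subst (_∈ js) (sym (coset-sends j σ σ∈S)) j∈js

      cosets-length : ∀ js → length (cosets js) ≡ length js * length S
      cosets-length []       = refl
      cosets-length (j ∷ js) =
        trans (length-++ (List.map (h j ∘P_) S)) (cong₂ _+_ (length-map (h j ∘P_) S) (cosets-length js))

      cosets-unique : ∀ {js} → Unique js → Unique (cosets js)
      cosets-unique [] = []
      cosets-unique {j ∷ js} (j∉js ∷ js!) = Unique.++⁺
        (Unique.map⁺ (λ {τ} {ρ} → ∘P-cancelˡ {h j} {τ} {ρ} (All.lookup perms (h∈G j))) S!)
        (cosets-unique js!)
        λ (v∈coset , v∈cosets) → let σ , σ∈S , v≡hσ = ∈-map⁻ (h j ∘P_) v∈coset in
          All.lookup j∉js (subst (_∈ js) (trans (cong (λ π → lookup π i) v≡hσ) (coset-sends j σ σ∈S)) (cosets-send js v∈cosets)) refl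

      cosets⊆G : All (_∈ G) (cosets (List.allFin 6))
      cosets⊆G = All.tabulate λ v∈ →
        let j , σ , _ , σ∈S , v≡hσ = ∈-cartesianProductWith⁻ (λ j σ → h j ∘P σ) (List.allFin 6) S v∈ in
        subst (_∈ G) (sym v≡hσ) (closed (h∈G j) (All.lookup S⊆G σ∈S))

    -- If the stabilizer of i were trivial, every σ ∈ G would equal h (σ i).
    nontrivial-stabilizer : 6 < length G → ∃[ t ] (t ∈ G × lookup t i ≡ i × t ≢ idP)
    nontrivial-stabilizer 6<|G| with Any.any? (λ t → (lookup t i ≟ᶠ i) ×-dec ¬? (t ≟ₚ idP)) G
    ... | yes found = find found
    ... | no none   = contradiction (Unique-⊆⇒length≤ nodup (All.tabulate among-h)) (ℕ.<⇒≱ 6<|G|)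
      where
      trivial : ∀ {ρ} → ρ ∈ G → lookup ρ i ≡ i → ρ ≡ idP
      trivial {ρ} ρ∈G fixes with ρ ≟ₚ idP
      ... | yes ρ≡id = ρ≡id
      ... | no  ρ≢id = contradiction (Any.map (λ { refl → fixes , ρ≢id }) ρ∈G) none

      among-h : ∀ {σ} → σ ∈ G → σ ∈ List.map h (List.allFin 6)
      among-h {σ} σ∈G = subst (_∈ List.map h (List.allFin 6)) h≡σ (∈-map⁺ h (∈-allFin j))
        where
        j = lookup σ i
        τ = proj₁ (inverse (h∈G j))

        τσ≡id : τ ∘P σ ≡ idP
        τσ≡id = trivial (closed (proj₁ (proj₂ (inverse (h∈G j)))) σ∈G)
          (trans (lookup-∘P τ σ i) (trans (cong (lookup τ) (sym (proj₂ (proj₂ (reach i j)))))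
                                          (lookup-inverse {h j} {τ} (proj₁ (proj₂ (proj₂ (inverse (h∈G j))))) i)))

        h≡σ : h j ≡ σ
        h≡σ = begin
          h j                ≡⟨ ∘P-identityʳ (h j) ⟨
          h j ∘P idP         ≡⟨ cong (h j ∘P_) τσ≡id ⟨
          h j ∘P (τ ∘P σ)    ≡⟨ ∘P-assoc (h j) τ σ ⟨
          (h j ∘P τ) ∘P σ    ≡⟨ cong (_∘P σ) (proj₂ (proj₂ (proj₂ (inverse (h∈G j))))) ⟩
          idP ∘P σ           ≡⟨ ∘P-identityˡ σ ⟩
          σ                  ∎

-- The search

module _ {m : ℕ} where
  open Decide (_≟ᶠ_ {m}) using (_∈?_)

  arrangements : ∀ n → List (Fin m) → List (Vec (Fin m) n)
  arrangements ℕ.zero    used = [] ∷ []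
  arrangements (ℕ.suc n) used = List.concatMap (λ x → List.map (x ∷_) (arrangements n (x ∷ used)))
                                              (List.filter (λ x → ¬? (x ∈? used)) (List.allFin m))

  ∈-arrangements : ∀ {n used} v → (∀ i j → lookup v i ≡ lookup v j → i ≡ j) → (∀ i → lookup v i ∉ used) →
                   v ∈ arrangements n used
  ∈-arrangements-tail : ∀ {n used x} v → (∀ i j → lookup (x ∷ v) i ≡ lookup (x ∷ v) j → i ≡ j) →
                        (∀ i → lookup v i ∉ used) → v ∈ arrangements n (x ∷ used)

  ∈-arrangements []      _         _     = here refl
  ∈-arrangements (x ∷ v) injective fresh =
    ∈-concat⁺′ (∈-map⁺ (x ∷_) (∈-arrangements-tail v injective (fresh ∘ suc)))
               (∈-map⁺ _ (∈-filter⁺ _ (∈-allFin x) (fresh zero)))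

  ∈-arrangements-tail v injective fresh = ∈-arrangements v
    (λ i j vi≡vj → suc-injective (injective (suc i) (suc j) vi≡vj))
    λ { i (here vi≡x) → contradiction (injective (suc i) zero vi≡x) λ () ; i (there vi∈used) → fresh i vi∈used }

sendingZeroTo : Fin 6 → List Perm
sendingZeroTo j = List.map (j ∷_) (arrangements 5 (j ∷ []))

∈-sendingZeroTo : ∀ {σ} → IsPerm σ → σ ∈ sendingZeroTo (lookup σ (# 0))
∈-sendingZeroTo {x ∷ v} injective = ∈-map⁺ (x ∷_) (∈-arrangements-tail v injective λ _ ())

-- search n gens explores the subgroups generated by gens and at most n − 1 further elements:
-- it rejects a closure K of the generators that has more than `order` elements or a point
-- with more than `stabilizerOrder` fixers, accepts K by `accept` once 0 reaches every point,
-- and otherwise tries every permutation sending 0 to the first point not yet reached.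
module Search (order stabilizerOrder : ℕ) (accept : List Perm → Bool) where
  open Decide _≟ₚ_ using (_∈?_)

  insertNew : List Perm → List Perm → List Perm → List Perm × List Perm
  insertNew []       S N = S , N
  insertNew (σ ∷ σs) S N = if ⌊ σ ∈? S ⌋ then insertNew σs S N else insertNew σs (σ ∷ S) (σ ∷ N)

  -- Breadth-first, with N the newest elements of S; abandoned as soon as S exceeds `order`
  -- elements, so the result need not be closed, only a duplicate-free list of products.
  grow : ℕ → List Perm → List Perm → List Perm → List Perm
  grow-from : ℕ → List Perm → List Perm × List Perm → List Perm
  grow ℕ.zero    gens S N         = S
  grow (ℕ.suc n) gens S []        = S
  grow (ℕ.suc n) gens S N@(_ ∷ _) = grow-from n gens (insertNew (cartesianProductWith _∘P_ gens N) S [])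
  grow-from n gens (S , N) = if order <ᵇ length S then S else grow n gens S N

  closure : List Perm → List Perm
  closure gens = grow order gens (idP ∷ []) (idP ∷ [])

  fixers : Fin 6 → List Perm → List Perm
  fixers i = List.filter (λ σ → lookup σ i ≟ᶠ i)

  overfull? : Decidable (λ K → ∃[ i ] stabilizerOrder < length (fixers i K))
  overfull? K = Fin.any? λ i → stabilizerOrder ℕ.<? length (fixers i K)

  unreached : List Perm → Maybe (Fin 6)
  unreached K = List.find (λ j → ¬? (Any.any? (λ σ → lookup σ (# 0) ≟ᶠ j) K)) (List.allFin 6)

  search : ℕ → List Perm → Bool
  explore : ℕ → List Perm → List Perm → Bool
  extend : ℕ → List Perm → List Perm → Maybe (Fin 6) → Bool
  search ℕ.zero    gens = false
  search (ℕ.suc n) gens = explore n gens (closure gens)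
  explore n gens K = (order <ᵇ length K) ∨ ⌊ overfull? K ⌋ ∨ extend n gens K (unreached K)
  extend n gens K nothing  = accept K
  extend n gens K (just j) = all (λ σ → search n (σ ∷ gens)) (sendingZeroTo j)

  module Sound {G : List Perm} (G-subgroup : IsSubgroup G)
    (order-bound : ∀ {K} → Unique K → All (_∈ G) K → length K ≤ order)
    (stabilizer-bound : ∀ {i K} → Unique K → All (_∈ G) K → All (λ σ → lookup σ i ≡ i) K → length K ≤ stabilizerOrder)
    (reach : ∀ j → ∃[ g ] (g ∈ G × lookup g (# 0) ≡ j))
    {P : Set} (accept-sound : ∀ {K} → All (_∈ G) K → T (accept K) → P)
    where
    open IsSubgroup G-subgroup

    Valid : List Perm × List Perm → Set
    Valid (S , N) = All (_∈ G) S × Unique S × All (_∈ G) N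

    insertNew-valid : ∀ σs {S N} → All (_∈ G) σs → Valid (S , N) → Valid (insertNew σs S N)
    insertNew-valid []       _ valid = valid
    insertNew-valid (σ ∷ σs) {S} {N} (σ∈G ∷ σs⊆G) (S⊆G , S! , N⊆G) with σ ∈? S
    ... | yes _   = insertNew-valid σs σs⊆G (S⊆G , S! , N⊆G)
    ... | no  σ∉S = insertNew-valid σs σs⊆G (σ∈G ∷ S⊆G , All.¬Any⇒All¬ S σ∉S ∷ S! , σ∈G ∷ N⊆G)

    products⊆G : ∀ {gens N} → All (_∈ G) gens → All (_∈ G) N → All (_∈ G) (cartesianProductWith _∘P_ gens N)
    products⊆G {gens} {N} gens⊆G N⊆G = All.tabulate λ σ∈ →
      let g , ρ , g∈gens , ρ∈N , σ≡gρ = ∈-cartesianProductWith⁻ _∘P_ gens N σ∈ in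
      subst (_∈ G) (sym σ≡gρ) (closed (All.lookup gens⊆G g∈gens) (All.lookup N⊆G ρ∈N))

    grow-valid : ∀ n gens S N → All (_∈ G) gens → Valid (S , N) →
                 All (_∈ G) (grow n gens S N) × Unique (grow n gens S N)
    grow-from-valid : ∀ n gens acc → All (_∈ G) gens → Valid acc →
                      All (_∈ G) (grow-from n gens acc) × Unique (grow-from n gens acc)
    grow-valid ℕ.zero    gens S N       _      (S⊆G , S! , _)   = S⊆G , S!
    grow-valid (ℕ.suc n) gens S []      _      (S⊆G , S! , _)   = S⊆G , S!
    grow-valid (ℕ.suc n) gens S (ρ ∷ N) gens⊆G (S⊆G , S! , N⊆G) =
      grow-from-valid n gens _ gens⊆G (insertNew-valid _ (products⊆G gens⊆G N⊆G) (S⊆G , S! , []))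
    grow-from-valid n gens (S , N) gens⊆G valid@(S⊆G , S! , _) with order <ᵇ length S
    ... | true  = S⊆G , S!
    ... | false = grow-valid n gens S N gens⊆G valid

    closure-valid : ∀ {gens} → All (_∈ G) gens → All (_∈ G) (closure gens) × Unique (closure gens)
    closure-valid gens⊆G = grow-valid order _ _ _ gens⊆G (hasId ∷ [] , [] ∷ [] , hasId ∷ [])

    search-sound : ∀ n gens → All (_∈ G) gens → T (search n gens) → P
    explore-sound : ∀ n gens K → All (_∈ G) gens → All (_∈ G) K → Unique K → T (explore n gens K) → P
    extend-sound : ∀ n gens K j → All (_∈ G) gens → All (_∈ G) K → T (extend n gens K j) → P

    search-sound (ℕ.suc n) gens gens⊆G found =
      let K⊆G , K! = closure-valid gens⊆G in explore-sound n gens (closure gens) gens⊆G K⊆G K! found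

    explore-sound n gens K gens⊆G K⊆G K! found with Equivalence.to T-∨ found
    ... | inj₁ too-large = contradiction (order-bound K! K⊆G) (ℕ.<⇒≱ (ℕ.<ᵇ⇒< order (length K) too-large))
    ... | inj₂ found′ with Equivalence.to T-∨ found′
    ...   | inj₁ overfull = let i , too-many = toWitness {a? = overfull? K} overfull in
      contradiction (stabilizer-bound (Unique.filter⁺ _ K!) (All.filter⁺ _ K⊆G) (All.all-filter (λ σ → lookup σ i ≟ᶠ i) K))
                    (ℕ.<⇒≱ too-many)
    ...   | inj₂ extended = extend-sound n gens K (unreached K) gens⊆G K⊆G extended

    extend-sound n gens K nothing  _      K⊆G accepted  = accept-sound K⊆G accepted
    extend-sound n gens K (just j) gens⊆G _   all-found =
      let g , g∈G , g0≡j = reach j in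
      search-sound n (g ∷ gens) (g∈G ∷ gens⊆G)
        (All.lookup (All.all⁺ _ (sendingZeroTo j) all-found)
                    (subst (λ k → g ∈ sendingZeroTo k) g0≡j (∈-sendingZeroTo (All.lookup perms g∈G))))

-- The right alternative holds for the transitive groups of order 12 with at most two
-- (4,2)-orbits; the hypothesis n_(4,2) ≥ 3 rules them out.
Certified : List Perm → Set
Certified K = (T (orbitBoundᵇ K λ42 3) × T (orbitBoundᵇ K λ411 3) × T (orbitBoundᵇ K λ33 3)) ⊎ T (orbitBoundᵇ K λ42 2)

certified? : Decidable Certified
certified? K = (T? (orbitBoundᵇ K λ42 3) ×-dec T? (orbitBoundᵇ K λ411 3) ×-dec T? (orbitBoundᵇ K λ33 3))
               ⊎-dec T? (orbitBoundᵇ K λ42 2)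

module _ {G : List Perm} (G-subgroup : IsSubgroup G) {n42 n411 n33 : ℕ}
         (count42 : OrbitCount G λ42 n42) (count411 : OrbitCount G λ411 n411) (count33 : OrbitCount G λ33 n33)
         (n42≥3 : n42 ≥ 3) where

  Certified-sound : ∀ {K} → All (_∈ G) K → Certified K → (n42 ≡ 3) × (n411 ≤ 3) × (n33 ≤ 3)
  Certified-sound {K} K⊆G (inj₁ (b42 , b411 , b33)) =
    ℕ.≤-antisym (orbitBoundᵇ-sound G-subgroup K λ42 3 K⊆G b42 count42) n42≥3 ,
    orbitBoundᵇ-sound G-subgroup K λ411 3 K⊆G b411 count411 ,
    orbitBoundᵇ-sound G-subgroup K λ33 3 K⊆G b33 count33
  Certified-sound {K} K⊆G (inj₂ b42) =
    contradiction n42≥3 (ℕ.<⇒≱ (s≤s (orbitBoundᵇ-sound G-subgroup K λ42 2 K⊆G b42 count42)))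

nontrivialFixingZero : List Perm
nontrivialFixingZero = List.filter (λ t → ¬? (t ≟ₚ idP)) (sendingZeroTo (# 0))

∈-nontrivialFixingZero : ∀ {t} → IsPerm t → lookup t (# 0) ≡ # 0 → t ≢ idP → t ∈ nontrivialFixingZero
∈-nontrivialFixingZero {t} t-perm t0≡0 t≢id =
  ∈-filter⁺ (λ t → ¬? (t ≟ₚ idP)) (subst (λ k → t ∈ sendingZeroTo k) t0≡0 (∈-sendingZeroTo t-perm)) t≢id

open Search 12 2 (λ K → ⌊ certified? K ⌋)

-- Stated through the name searchFrom: comparing two elaborations of `all (λ t → search …) …`
-- would make the type checker re-run the whole search.
searchFrom : Perm → Bool
searchFrom t = search 4 (t ∷ [])

searchFrom-succeeds : all searchFrom nontrivialFixingZero ≡ true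
searchFrom-succeeds = refl

searchFrom-nontrivialFixingZero : ∀ {t} → t ∈ nontrivialFixingZero → T (search 4 (t ∷ []))
searchFrom-nontrivialFixingZero {t} t∈ =
  Equivalence.from (T-≡ {searchFrom t}) (all-true⇒ searchFrom nontrivialFixingZero searchFrom-succeeds t∈)

corollary2p7 : (G : List Perm) → IsSubgroup G →
    (n51 n42 n411 n33 : ℕ) →
    OrbitCount G λ51 n51 → OrbitCount G λ42 n42 →
    OrbitCount G λ411 n411 → OrbitCount G λ33 n33 →
    n51 ≡ 1 → n42 ≥ 3 → length G ≡ 12 →
    (n42 ≡ 3) × (n411 ≤ 3) × (n33 ≤ 3)
corollary2p7 G G-subgroup _ _ _ _ count51 count42 count411 count33 refl n42≥3 |G|≡12 =
  let t , t∈G , t0≡0 , t≢id = nontrivial-stabilizer (# 0) (subst (6 <_) (sym |G|≡12) (ℕ.<ᵇ⇒< 6 12 _)) in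
  search-sound 4 (t ∷ []) (t∈G ∷ [])
    (searchFrom-nontrivialFixingZero (∈-nontrivialFixingZero (All.lookup perms t∈G) t0≡0 t≢id))
  where
  open IsSubgroup G-subgroup
  reach = Orbits.transitive G-subgroup count51
  open Transitive G-subgroup reach

  order-bound : ∀ {K} → Unique K → All (_∈ G) K → length K ≤ 12
  order-bound K! K⊆G = subst (_ ≤_) |G|≡12 (Unique-⊆⇒length≤ K! K⊆G)

  stabilizer-bound : ∀ {i K} → Unique K → All (_∈ G) K → All (λ σ → lookup σ i ≡ i) K → length K ≤ 2
  stabilizer-bound {i} K! K⊆G fixes = ℕ.*-cancelˡ-≤ 6 (subst (_ ≤_) |G|≡12 (orbit-stabilizer i K! K⊆G fixes))

  open Sound G-subgroup order-bound stabilizer-bound (reach (# 0))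
    (λ {K} K⊆G certified → Certified-sound G-subgroup count42 count411 count33 n42≥3 K⊆G
                              (toWitness {a? = certified? K} certified))
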